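{- There are infinitely many pairwise non-isomorphic connected graphs $G$ with vertex-connectivity $\kappa(G)=1$ that admit an IRC-coloring.
   Context: Private neighbors. For $S\subseteq V(G)$ and $v\in S$, $pn[v,S]=N[v]\setminus\bigcup_{u\in S\setminus\{v\}}N[u]$, where $N[\cdot]$ is the closed neighborhood. $S$ is irredundant if $pn[v,S]\ne\emptyset$ for all $v\in S$. Rainbow committees and IRC-colorings. For a proper coloring of $G$ with nonempty color classes $V_1,\dots,V_k$, a rainbow committee is a set containing exactly one vertex of each color class. An irredundance compelling coloring (IRC-coloring) is a proper coloring in which every rainbow committee is an irredundant set. -}

module Defs where

open import Data.Nat using (ℕ; _≤_)
open import Data.Fin using (Fin)
open import Data.Fin.Subset using (Subset; _∈_; _∉_; ∣_∣; ⁅_⁆)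
open import Data.Product using (Σ; ∃; ∃-syntax; _×_; _,_)
open import Data.Sum using (_⊎_)
open import Relation.Binary.PropositionalEquality using (_≡_; _≢_)
open import Relation.Nullary using (¬_)
open import Function.Bundles using (_↔_; Inverse)

record Graph : Set₁ where
  field
    order : ℕ
    Adj   : Fin order → Fin order → Set
    sym   : ∀ {u v} → Adj u v → Adj v u
    irrefl : ∀ {u} → ¬ Adj u u
open Graph public

record _≅_ (G H : Graph) : Set where
  field
    bij : Fin (order G) ↔ Fin (order H)
    pres : ∀ u v → (Adj G u v → Adj H (Inverse.to bij u) (Inverse.to bij v))
                 × (Adj H (Inverse.to bij u) (Inverse.to bij v) → Adj G u v)

module _ (G : Graph) where
  private
    n = order G
    V = Fin n

  data ReachAvoiding (A : Subset n) : V → V → Set where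
    here : ∀ {u} → u ∉ A → ReachAvoiding A u u
    step : ∀ {u w v} → u ∉ A → Adj G u w → ReachAvoiding A w v → ReachAvoiding A u v

  -- Connected graph: nonempty and every two vertices are joined by a walk.
  -- (walks avoiding the empty set = ordinary walks)
  Connected : Set
  Connected = V × (∀ (u v : V) → ReachAvoiding Data.Fin.Subset.⊥ u v)

  Disconnecting : Subset n → Set
  Disconnecting S =
    (Σ V λ u → Σ V λ v → u ∉ S × v ∉ S × ¬ ReachAvoiding S u v)
    ⊎ (∀ u v → u ∉ S → v ∉ S → u ≡ v)

  VertexConnectivity : ℕ → Set
  VertexConnectivity k =
    (Σ (Subset n) λ S → ∣ S ∣ ≡ k × Disconnecting S)
    × (∀ S → Disconnecting S → k ≤ ∣ S ∣)

  InClosedNbhd : V → V → Set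
  InClosedNbhd v w = w ≡ v ⊎ Adj G v w

  PrivateNeighbour : Subset n → V → V → Set
  PrivateNeighbour S v w = InClosedNbhd v w × (∀ u → u ∈ S → u ≢ v → ¬ InClosedNbhd u w)

  Irredundant : Subset n → Set
  Irredundant S = ∀ v → v ∈ S → ∃[ w ] PrivateNeighbour S v w

  ProperColoring : (k : ℕ) → (V → Fin k) → Set
  ProperColoring k c = (∀ u v → Adj G u v → c u ≢ c v) × (∀ i → ∃[ v ] c v ≡ i)

  RainbowCommittee : (k : ℕ) → (V → Fin k) → Subset n → Set
  RainbowCommittee k c R =
    ∀ i → Σ V λ v → (v ∈ R × c v ≡ i) × (∀ w → w ∈ R → c w ≡ i → w ≡ v)

  IRCColoring : (k : ℕ) → (V → Fin k) → Set
  IRCColoring k c = ProperColoring k c × (∀ R → RainbowCommittee k c R → Irredundant R)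

  AdmitsIRCColoring : Set
  AdmitsIRCColoring = Σ ℕ λ k → Σ (V → Fin k) λ c → IRCColoring k c

{-# OPTIONS --safe #-}
module Submission where

open import Defs hiding (sym)
open import Data.Nat using (ℕ; _+_; _≤_; s≤s; z≤n)
open import Data.Nat.Properties using (≤-trans; +-cancelˡ-≡)
open import Data.Fin using (Fin; _≟_) renaming (zero to fz; suc to fs)
open import Data.Fin.Subset using (_∈_; _∉_; ∣_∣; ⁅_⁆; Nonempty) renaming (⊥ to ∅)
open import Data.Fin.Subset.Properties
  using (∉⊥; x∈⁅x⁆; x≢y⇒x∉⁅y⁆; ∣⁅x⁆∣≡1; nonempty?; Empty-unique; x∈p⇒∣p-x∣<∣p∣)
open import Data.Fin.Permutation using (↔⇒≡)
open import Data.Product using (Σ; ∃₂; _×_; _,_; proj₁)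
open import Data.Sum using (_⊎_; inj₁; inj₂)
open import Data.Empty using (⊥; ⊥-elim)
open import Data.Unit using (⊤; tt)
open import Function using (_∘′_)
open import Relation.Binary.PropositionalEquality using (_≡_; _≢_; refl; sym; trans; subst)
open import Relation.Nullary using (¬_; yes; no)

-- Glue a 4-cycle to a complete bipartite graph K_{2,n+2} at a vertex of the
-- 2-side. The glueing vertex is a cut vertex, so κ = 1, and the orders 7 + n
-- separate the graphs. The graph is bipartite with minimum degree 2, and for
-- such graphs the bipartition is an IRC-coloring: a rainbow committee is a
-- pair {v, o} of differently coloured vertices, and a neighbour w ≠ o of v has
-- the colour of o, so it is neither o nor adjacent to o.

module _ {G : Graph} where
  private
    V = Fin (order G)

  _++ʳ_ : ∀ {A u v w} → ReachAvoiding G A u v → ReachAvoiding G A v w → ReachAvoiding G A u w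
  here _       ++ʳ q = q
  step u∉ a p ++ʳ q = step u∉ a (p ++ʳ q)

  reach-source∉ : ∀ {A u v} → ReachAvoiding G A u v → u ∉ A
  reach-source∉ (here u∉)     = u∉
  reach-source∉ (step u∉ _ _) = u∉

  reach-reverse : ∀ {A u v} → ReachAvoiding G A u v → ReachAvoiding G A v u
  reach-reverse (here u∉)     = here u∉
  reach-reverse (step u∉ a p) = reach-reverse p ++ʳ step (reach-source∉ p) (Graph.sym G a) (here u∉)

  connected-via : (r : V) → (∀ u → ReachAvoiding G ∅ u r) → Connected G
  connected-via r toR = r , λ u v → toR u ++ʳ reach-reverse (toR v)

  reach-preserves : ∀ {A} (P : V → Set) → (∀ {u w} → P u → Adj G u w → w ∉ A → P w) →
                    ∀ {u v} → P u → ReachAvoiding G A u v → P v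
  reach-preserves P closed Pu (here _)     = Pu
  reach-preserves P closed Pu (step _ a p) = reach-preserves P closed (closed Pu a (reach-source∉ p)) p

  disconnecting⇒nonempty : Connected G → ∀ {u v : V} → u ≢ v →
                           ∀ S → Disconnecting G S → Nonempty S
  disconnecting⇒nonempty (_ , conn) u≢v S d with nonempty? S
  ... | yes ne = ne
  ... | no ¬ne with Empty-unique ¬ne | d
  ...   | refl | inj₁ (u , v , _ , _ , ¬reach) = ⊥-elim (¬reach (conn u v))
  ...   | refl | inj₂ trivial                  = ⊥-elim (u≢v (trivial _ _ ∉⊥ ∉⊥))

  cutVertex⇒κ≡1 : Connected G → ∀ {u v : V} → u ≢ v → ∀ x → Disconnecting G ⁅ x ⁆ →
                  VertexConnectivity G 1
  cutVertex⇒κ≡1 conn u≢v x d = (⁅ x ⁆ , ∣⁅x⁆∣≡1 x , d) , minimal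
    where
    minimal : ∀ S → Disconnecting G S → 1 ≤ ∣ S ∣
    minimal S dS with disconnecting⇒nonempty conn u≢v S dS
    ... | _ , y∈S = ≤-trans (s≤s z≤n) (x∈p⇒∣p-x∣<∣p∣ y∈S)

≅⇒order≡ : ∀ {G H} → G ≅ H → order G ≡ order H
≅⇒order≡ iso = ↔⇒≡ (_≅_.bij iso)

≢-both⇒≡ : ∀ {a b d : Fin 2} → a ≢ d → b ≢ d → a ≡ b
≢-both⇒≡ {fz}    {fz}    _   _   = refl
≢-both⇒≡ {fs fz} {fs fz} _   _   = refl
≢-both⇒≡ {fz}    {fs fz} {fz}    a≢d _   = ⊥-elim (a≢d refl)
≢-both⇒≡ {fz}    {fs fz} {fs fz} _   b≢d = ⊥-elim (b≢d refl)
≢-both⇒≡ {fs fz} {fz}    {fz}    _   b≢d = ⊥-elim (b≢d refl)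
≢-both⇒≡ {fs fz} {fz}    {fs fz} a≢d _   = ⊥-elim (a≢d refl)

module _ (G : Graph) {k} (c : Fin (order G) → Fin k) where
  committee-colour-injective : ∀ {R} → RainbowCommittee G k c R →
                               ∀ {u v} → u ∈ R → v ∈ R → c u ≡ c v → u ≡ v
  committee-colour-injective rc {u} {v} u∈ v∈ cu≡cv with rc (c v)
  ... | _ , _ , unique = trans (unique u u∈ cu≡cv) (sym (unique v v∈ refl))

module _ (G : Graph) (c : Fin (order G) → Fin 2)
         (proper : ProperColoring G 2 c)
         (twoNeighbours : ∀ v → ∃₂ λ a b → a ≢ b × Adj G v a × Adj G v b) where
  private
    V = Fin (order G)
    bichromatic : ∀ u v → Adj G u v → c u ≢ c v
    bichromatic = proj₁ proper

  neighbour-colour≢ : ∀ {v x} → Adj G v x → c x ≢ c v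
  neighbour-colour≢ vx cx≡cv = bichromatic _ _ vx (sym cx≡cv)

  neighbour-avoiding : ∀ v (o : V) → Σ V λ w → Adj G v w × w ≢ o
  neighbour-avoiding v o with twoNeighbours v
  ... | a , b , a≢b , va , vb with a ≟ o
  ...   | yes refl = b , vb , λ b≡a → a≢b (sym b≡a)
  ...   | no a≢o   = a , va , a≢o

  ∉closedNbhd-of-same-colour : ∀ {o w} → c w ≡ c o → w ≢ o → ¬ InClosedNbhd G o w
  ∉closedNbhd-of-same-colour cw≡co w≢o (inj₁ w≡o) = w≢o w≡o
  ∉closedNbhd-of-same-colour cw≡co w≢o (inj₂ ow)  = bichromatic _ _ ow (sym cw≡co)

  rainbow-irredundant : ∀ R → RainbowCommittee G 2 c R → Irredundant G R
  rainbow-irredundant R rc v v∈ with twoNeighbours v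
  ... | a , _ , _ , va , _ with rc (c a)
  ...   | o , (_ , co≡ca) , unique with neighbour-avoiding v o
  ...     | w , vw , w≢o = w , inj₂ vw , private-to-v
    where
    private-to-v : ∀ u → u ∈ R → u ≢ v → ¬ InClosedNbhd G u w
    private-to-v u u∈ u≢v = subst (λ x → ¬ InClosedNbhd G x w) (sym u≡o)
                              (∉closedNbhd-of-same-colour cw≡co w≢o)
      where
      cu≢cv : c u ≢ c v
      cu≢cv = u≢v ∘′ committee-colour-injective G c rc u∈ v∈
      u≡o : u ≡ o
      u≡o = unique u u∈ (≢-both⇒≡ cu≢cv (neighbour-colour≢ va))
      cw≡co : c w ≡ c o
      cw≡co = trans (≢-both⇒≡ (neighbour-colour≢ vw) (neighbour-colour≢ va)) (sym co≡ca)

  bipartition-IRC : IRCColoring G 2 c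
  bipartition-IRC = proper , rainbow-irredundant

pattern hub   = fz
pattern sq₁   = fs fz
pattern sq₂   = fs (fs fz)
pattern sq₃   = fs (fs (fs fz))
pattern twin  = fs (fs (fs (fs fz)))
pattern mid k = fs (fs (fs (fs (fs k))))

data Edge (n : ℕ) : Fin (7 + n) → Fin (7 + n) → Set where
  hub-sq₁  : Edge n hub sq₁
  sq₁-sq₂  : Edge n sq₁ sq₂
  sq₂-sq₃  : Edge n sq₂ sq₃
  sq₃-hub  : Edge n sq₃ hub
  hub-mid  : ∀ k → Edge n hub (mid k)
  twin-mid : ∀ k → Edge n twin (mid k)

SquareAdj : ∀ n → Fin (7 + n) → Fin (7 + n) → Set
SquareAdj n u v = Edge n u v ⊎ Edge n v u

squareBiclique : ℕ → Graph
squareBiclique n = record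
  { order  = 7 + n
  ; Adj    = SquareAdj n
  ; sym    = λ { (inj₁ e) → inj₂ e ; (inj₂ e) → inj₁ e }
  ; irrefl = λ { (inj₁ ()) ; (inj₂ ()) }
  }

module _ (n : ℕ) where
  private
    G = squareBiclique n
    V = Fin (7 + n)

  _⟶_ : ∀ {u w v} → Edge n u w → ReachAvoiding G ∅ w v → ReachAvoiding G ∅ u v
  e ⟶ p = step ∉⊥ (inj₁ e) p

  _⟵_ : ∀ {u w v} → Edge n w u → ReachAvoiding G ∅ w v → ReachAvoiding G ∅ u v
  e ⟵ p = step ∉⊥ (inj₂ e) p

  infixr 5 _⟶_ _⟵_

  toHub : ∀ u → ReachAvoiding G ∅ u hub
  toHub hub     = here ∉⊥
  toHub sq₁     = hub-sq₁ ⟵ here ∉⊥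
  toHub sq₂     = sq₁-sq₂ ⟵ toHub sq₁
  toHub sq₃     = sq₃-hub ⟶ here ∉⊥
  toHub twin    = twin-mid fz ⟶ hub-mid fz ⟵ here ∉⊥
  toHub (mid k) = hub-mid k ⟵ here ∉⊥

  squareBiclique-connected : Connected G
  squareBiclique-connected = connected-via hub toHub

  InSquare : V → Set
  InSquare sq₁ = ⊤
  InSquare sq₂ = ⊤
  InSquare sq₃ = ⊤
  InSquare _   = ⊥

  square-closed : ∀ {u w} → InSquare u → SquareAdj n u w → w ∉ ⁅ hub ⁆ → InSquare w
  square-closed {sq₁} _ (inj₁ sq₁-sq₂) _ = tt
  square-closed {sq₂} _ (inj₁ sq₂-sq₃) _ = tt
  square-closed {sq₂} _ (inj₂ sq₁-sq₂) _ = tt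
  square-closed {sq₃} _ (inj₂ sq₂-sq₃) _ = tt
  square-closed {sq₁} _ (inj₂ hub-sq₁) w∉ = w∉ (x∈⁅x⁆ hub)
  square-closed {sq₃} _ (inj₁ sq₃-hub) w∉ = w∉ (x∈⁅x⁆ hub)

  hub-cut : Disconnecting G ⁅ hub ⁆
  hub-cut = inj₁ (sq₁ , mid fz , x≢y⇒x∉⁅y⁆ {y = hub} (λ ()) , x≢y⇒x∉⁅y⁆ {y = hub} (λ ())
                 , reach-preserves InSquare square-closed tt)

  squareBiclique-κ≡1 : VertexConnectivity G 1
  squareBiclique-κ≡1 = cutVertex⇒κ≡1 squareBiclique-connected {sq₁} {sq₂} (λ ()) hub hub-cut

  side : V → Fin 2
  side hub     = fz
  side sq₁     = fs fz
  side sq₂     = fz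
  side sq₃     = fs fz
  side twin    = fz
  side (mid _) = fs fz

  edge-bichromatic : ∀ {u v} → Edge n u v → side u ≢ side v
  edge-bichromatic hub-sq₁      ()
  edge-bichromatic sq₁-sq₂      ()
  edge-bichromatic sq₂-sq₃      ()
  edge-bichromatic sq₃-hub      ()
  edge-bichromatic (hub-mid _)  ()
  edge-bichromatic (twin-mid _) ()

  side-proper : ProperColoring G 2 side
  side-proper = (λ { _ _ (inj₁ e) → edge-bichromatic e ; _ _ (inj₂ e) → edge-bichromatic e ∘′ sym })
              , λ { fz → hub , refl ; (fs fz) → sq₁ , refl }

  squareBiclique-twoNeighbours : ∀ v → ∃₂ λ a b → a ≢ b × SquareAdj n v a × SquareAdj n v b
  squareBiclique-twoNeighbours hub     = sq₁ , sq₃ , (λ ()) , inj₁ hub-sq₁ , inj₂ sq₃-hub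
  squareBiclique-twoNeighbours sq₁     = hub , sq₂ , (λ ()) , inj₂ hub-sq₁ , inj₁ sq₁-sq₂
  squareBiclique-twoNeighbours sq₂     = sq₁ , sq₃ , (λ ()) , inj₂ sq₁-sq₂ , inj₁ sq₂-sq₃
  squareBiclique-twoNeighbours sq₃     = sq₂ , hub , (λ ()) , inj₂ sq₂-sq₃ , inj₁ sq₃-hub
  squareBiclique-twoNeighbours twin    = mid fz , mid (fs fz) , (λ ()) , inj₁ (twin-mid _) , inj₁ (twin-mid _)
  squareBiclique-twoNeighbours (mid k) = hub , twin , (λ ()) , inj₂ (hub-mid k) , inj₂ (twin-mid k)

  squareBiclique-IRC : AdmitsIRCColoring G
  squareBiclique-IRC = 2 , side , bipartition-IRC G side side-proper squareBiclique-twoNeighbours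

theorem5 : Σ (ℕ → Graph) λ G →
    (∀ i → Connected (G i) × VertexConnectivity (G i) 1 × AdmitsIRCColoring (G i))
    × (∀ i j → i ≢ j → ¬ (G i ≅ G j))
theorem5 = squareBiclique
         , (λ n → squareBiclique-connected n , squareBiclique-κ≡1 n , squareBiclique-IRC n)
         , λ i j i≢j iso → i≢j (+-cancelˡ-≡ 7 i j (≅⇒order≡ iso))
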